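{- Let $A_1,\dots,A_n$ be finite multisets and $A=A_1\cup\cdots\cup A_n$. For every reduced forest $F$ with leaves in $A$ which is not mixing, $$\sum_{c\in\mathcal{C}_F}(-1)^{|c|}=0.$$
   Context: Elements of $A$ are regarded as distinguishable, each belonging to a specified $A_i$. A reduced forest with leaves in $A$ is a finite forest of rooted trees with unordered children whose leaves (a one-vertex tree is a single leaf) are labelled bijectively by the elements of $A$, each non-leaf vertex having at least two children. $F$ is mixing if for every vertex all of whose children are leaves, those children are labelled by elements belonging to at least two distinct multisets $A_i\ne A_j$. A gap-free colouring of $F$ of length $r\ge 0$ is a map from vertices to $\{0,\dots,r\}$ using every colour, colouring every leaf $0$, with colours strictly decreasing from a vertex to each of its children; $|c|=r$. It is weakly-mixing if some vertex of colour $1$ has two children labelled by elements of two distinct multisets $A_i\ne A_j$, or if colour $1$ is not used. $\mathcal{C}_F$ is the set of gap-free weakly-mixing colourings of $F$. -}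

module Defs where

open import Data.Nat using (ℕ; zero; suc)
open import Data.Fin using (Fin; zero; suc; _<_; toℕ)
import Data.Nat as ℕ
open import Data.Fin.Properties using (_≟_; any?; all?; _<?_)
open import Data.Maybe using (Maybe; nothing; just; _>>=_)
open import Data.Maybe.Properties using (≡-dec)
open import Data.List using (List; []; _∷_; concatMap; map; filter; upTo; allFin)
open import Data.Integer using (ℤ; -1ℤ; _^_; _+_; 0ℤ)
open import Data.Product using (Σ; ∃; _×_; _,_)
open import Data.Sum using (_⊎_)
open import Relation.Binary.PropositionalEquality using (_≡_; _≢_)
open import Relation.Nullary using (¬_; Dec; ¬?)
open import Relation.Nullary.Decidable using (_×-dec_; _⊎-dec_; _→-dec_)
open import Function using (Injective)

-- The multisets A₁,…,Aₙ: A is identified with Fin m (distinguishable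
-- elements) and  cls : Fin m → Fin n  says which Aᵢ each element is in.

module _ {k : ℕ} (parent : Fin k → Maybe (Fin k)) where

  ChildOf : Fin k → Fin k → Set
  ChildOf w v = parent w ≡ just v

  IsLeaf : Fin k → Set
  IsLeaf v = ∀ w → ¬ ChildOf w v

  walk : ℕ → Fin k → Maybe (Fin k)
  walk zero    v = just v
  walk (suc n) v = parent v >>= walk n

-- Reduced forests with leaves labelled bijectively by Fin m.
-- Vertices are Fin k; roots have parent nothing; children unordered.

record ReducedForest (m : ℕ) : Set where
  field
    k       : ℕ
    parent  : Fin k → Maybe (Fin k)
    lab     : Fin m → Fin k
    acyclic : ∀ v → walk parent k v ≡ nothing
    lab-inj  : Injective _≡_ _≡_ lab
    lab-leaf : ∀ a → IsLeaf parent (lab a)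
    leaf-lab : ∀ v → IsLeaf parent v → ∃ λ a → lab a ≡ v
    reduced : ∀ v w → ChildOf parent w v →
              ∃ λ w′ → w′ ≢ w × ChildOf parent w′ v

module _ {n m : ℕ} (cls : Fin m → Fin n) (F : ReducedForest m) where
  open ReducedForest F

  HasMixedLeafChildren : Fin k → Set
  HasMixedLeafChildren v =
    ∃ λ a → ∃ λ b → ChildOf parent (lab a) v × ChildOf parent (lab b) v
                    × cls a ≢ cls b

  Mixing : Set
  Mixing = ∀ v → ¬ IsLeaf parent v →
           (∀ w → ChildOf parent w v → IsLeaf parent w) →
           HasMixedLeafChildren v

  IsGapFree : (r : ℕ) → (Fin k → Fin (suc r)) → Set
  IsGapFree r c =
      (∀ (j : Fin (suc r)) → ∃ λ v → c v ≡ j)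
    × (∀ v → IsLeaf parent v → c v ≡ zero)
    × (∀ v w → ChildOf parent w v → c w < c v)

  IsWeaklyMixing : (r : ℕ) → (Fin k → Fin (suc r)) → Set
  IsWeaklyMixing r c =
      (∃ λ v → (toℕ (c v) ≡ 1) × HasMixedLeafChildren v)
    ⊎ (∀ v → toℕ (c v) ≢ 1)

  InC : (r : ℕ) → (Fin k → Fin (suc r)) → Set
  InC r c = IsGapFree r c × IsWeaklyMixing r c

  private
    childOf? : ∀ w v → Dec (ChildOf parent w v)
    childOf? w v = ≡-dec _≟_ (parent w) (just v)

    isLeaf? : ∀ v → Dec (IsLeaf parent v)
    isLeaf? v = all? λ w → ¬? (childOf? w v)

    mixed? : ∀ v → Dec (HasMixedLeafChildren v)
    mixed? v = any? λ a → any? λ b →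
      childOf? (lab a) v ×-dec childOf? (lab b) v ×-dec ¬? (cls a ≟ cls b)

  InC? : ∀ r c → Dec (InC r c)
  InC? r c =
    ((all? λ j → any? λ v → c v ≟ j)
       ×-dec (all? λ v → isLeaf? v →-dec (c v ≟ zero))
       ×-dec (all? λ v → all? λ w → childOf? w v →-dec (c w <? c v)))
    ×-dec ((any? λ v → (toℕ (c v) ℕ.≟ 1) ×-dec mixed? v)
           ⊎-dec (all? λ v → ¬? (toℕ (c v) ℕ.≟ 1)))

allFuns : (k s : ℕ) → List (Fin k → Fin s)
allFuns zero    s = (λ ()) ∷ []
allFuns (suc k) s =
  concatMap (λ x → map (λ f → λ { zero → x ; (suc i) → f i }) (allFuns k s))
            (allFin s)

sumℤ : List ℤ → ℤ
sumℤ []       = 0ℤ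
sumℤ (x ∷ xs) = x + sumℤ xs

𝒞 : ∀ {n m} (cls : Fin m → Fin n) (F : ReducedForest m) (r : ℕ) →
    List (Fin (ReducedForest.k F) → Fin (suc r))
𝒞 cls F r = filter (InC? cls F r) (allFuns (ReducedForest.k F) (suc r))

-- Σ_{c ∈ 𝒞_F} (-1)^{|c|}.  A gap-free colouring of length r uses r+1
-- colours on k vertices, so r ≤ k; we sum over r = 0,…,k.
signedSum : ∀ {n m} (cls : Fin m → Fin n) (F : ReducedForest m) → ℤ
signedSum cls F =
  sumℤ (concatMap (λ r → map (λ _ → -1ℤ ^ r) (𝒞 cls F r))
                  (upTo (suc (ReducedForest.k F))))

module Submission where

open import Defs
open import Data.Nat using (ℕ; zero; suc; pred; _≤_; _<_; z≤n; s≤s; z<s; >-nonZero)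
import Data.Nat as ℕ
open import Data.Nat.Properties
open import Data.Fin using (Fin; toℕ; fromℕ<) renaming (zero to fzero; suc to fsuc)
import Data.Fin.Properties as Fin
open import Data.Maybe using (just)
open import Data.Maybe.Properties using (≡-dec)
open import Data.Vec as Vec using (Vec; tabulate; lookup; _[_]≔_)
open import Data.Vec.Properties
  using (lookup∘tabulate; tabulate∘lookup; tabulate-cong; lookup-map; lookup∘update; lookup∘update′)
open import Data.List using (List; []; _∷_; map; _++_; length; concatMap; upTo; allFin)
open import Data.List.Properties using (map-concatMap; concatMap-cong; map-∘)
open import Data.List.Membership.Propositional using (_∈_; _∉_)
open import Data.List.Membership.Propositional.Properties
  using (∈-∃++; ∈-++⁺ʳ; ∈-concatMap⁺; ∈-concatMap⁻; ∈-map⁺; ∈-map⁻; ∈-filter⁺; ∈-filter⁻; ∈-upTo⁺; ∈-allFin)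
open import Data.List.Relation.Unary.Any as Any using (here; there)
open import Data.List.Relation.Unary.All as All using (All; _∷_)
import Data.List.Relation.Unary.All.Properties as All
open import Data.List.Relation.Unary.AllPairs as AllPairs using (AllPairs; []; _∷_)
import Data.List.Relation.Unary.AllPairs.Properties as AllPairs
open import Data.List.Relation.Unary.Unique.Propositional using (Unique)
open import Data.List.Relation.Unary.Unique.Propositional.Properties using (upTo⁺; allFin⁺)
open import Data.Integer using (ℤ; -1ℤ; _^_; _+_; -_; 0ℤ)
import Data.Integer.Properties as ℤ
open import Algebra.Properties.CommutativeSemigroup ℤ.+-commutativeSemigroup using (x∙yz≈y∙xz)
open import Data.Product using (∃; _×_; _,_; proj₁; proj₂)
open import Data.Sum using (_⊎_; inj₁; inj₂)
import Data.Sum as Sum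
open import Data.Empty using (⊥-elim)
open import Relation.Binary.PropositionalEquality
open import Relation.Nullary using (¬_; Dec; yes; no; ¬?)
open import Relation.Nullary.Decidable using (_×-dec_; _→-dec_; decidable-stable)
open import Function using (_∘_; _∘′_)

-- Proof by a sign-reversing involution.  As F is not mixing, some non-leaf
-- vertex v has only leaf children, all labelled from one multiset.  For c
-- in 𝒞_F let j = c(v) ≥ 1.  If v is the only vertex of colour j and j ≥ 2,
-- merge colour j into j-1; otherwise move v alone to a new colour j+1.
-- Both operations stay in 𝒞_F (the vertex of colour 1 required by weak
-- mixing is never v), undo each other, and change |c| by one.

module _ {X : Set} where

  sumℤ-delete : (w : X → ℤ) (pre : List X) {y : X} {post : List X} →
                sumℤ (map w (pre ++ y ∷ post)) ≡ w y + sumℤ (map w (pre ++ post))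
  sumℤ-delete w []        = refl
  sumℤ-delete w (a ∷ pre) {y} {post} = begin
    w a + sumℤ (map w (pre ++ y ∷ post))      ≡⟨ cong (w a +_) (sumℤ-delete w pre) ⟩
    w a + (w y + sumℤ (map w (pre ++ post)))  ≡⟨ x∙yz≈y∙xz (w a) (w y) _ ⟩
    w y + (w a + sumℤ (map w (pre ++ post)))  ∎
    where open ≡-Reasoning

  All-delete : ∀ {P : X → Set} (pre : List X) {y post} →
               All P (pre ++ y ∷ post) → All P (pre ++ post)
  All-delete []        (_ ∷ ps) = ps
  All-delete (a ∷ pre) (p ∷ ps) = p ∷ All-delete pre ps

  Unique-delete : ∀ (pre : List X) {y post} →
                  Unique (pre ++ y ∷ post) → Unique (pre ++ post)
  Unique-delete []        (_ ∷ u) = u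
  Unique-delete (a ∷ pre) (a∉ ∷ u) = All-delete pre a∉ ∷ Unique-delete pre u

  Unique-deleted∉ : ∀ (pre : List X) {y post} →
                    Unique (pre ++ y ∷ post) → y ∉ pre ++ post
  Unique-deleted∉ []        (y∉ ∷ _) = All.All¬⇒¬Any y∉
  Unique-deleted∉ (a ∷ pre) (a∉ ∷ _) (here refl) =
    All.lookup a∉ (∈-++⁺ʳ pre (here refl)) refl
  Unique-deleted∉ (a ∷ pre) (_ ∷ u)  (there z∈) = Unique-deleted∉ pre u z∈

  ∈-undelete : ∀ (pre : List X) {y post z} → z ∈ pre ++ post → z ∈ pre ++ y ∷ post
  ∈-undelete []        z∈          = there z∈
  ∈-undelete (a ∷ pre) (here z≡a)  = here z≡a
  ∈-undelete (a ∷ pre) (there z∈)  = there (∈-undelete pre z∈)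

  ∈-delete : ∀ (pre : List X) {y post z} → z ∈ pre ++ y ∷ post → z ≢ y → z ∈ pre ++ post
  ∈-delete []        (here z≡y)  z≢y = ⊥-elim (z≢y z≡y)
  ∈-delete []        (there z∈)  _   = z∈
  ∈-delete (a ∷ pre) (here z≡a)  _   = here z≡a
  ∈-delete (a ∷ pre) (there z∈)  z≢y = there (∈-delete pre z∈ z≢y)

  length-delete : ∀ (pre : List X) {y post} →
                  suc (length (pre ++ post)) ≡ length (pre ++ y ∷ post)
  length-delete []        = refl
  length-delete (a ∷ pre) = cong suc (length-delete pre)

  sumℤ-delete-pair : (w : X → ℤ) (pre : List X) {x y : X} {post : List X} → w y ≡ - w x →
                     sumℤ (map w (x ∷ pre ++ y ∷ post)) ≡ sumℤ (map w (pre ++ post))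
  sumℤ-delete-pair w pre {x} {y} {post} wy≡-wx = begin
    w x + sumℤ (map w (pre ++ y ∷ post))      ≡⟨ cong (w x +_) (sumℤ-delete w pre) ⟩
    w x + (w y + rest)                        ≡⟨ ℤ.+-assoc (w x) (w y) rest ⟨
    (w x + w y) + rest                        ≡⟨ cong (λ z → (w x + z) + rest) wy≡-wx ⟩
    (w x + - w x) + rest                      ≡⟨ cong (_+ rest) (ℤ.+-inverseʳ (w x)) ⟩
    0ℤ + rest                                 ≡⟨ ℤ.+-identityˡ rest ⟩
    rest                                      ∎
    where
    open ≡-Reasoning
    rest : ℤ
    rest = sumℤ (map w (pre ++ post))

  record SignReversing (w : X → ℤ) (ι : X → X) (L : List X) : Set where
    field
      closed     : ∀ {x} → x ∈ L → ι x ∈ L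
      involutive : ∀ {x} → x ∈ L → ι (ι x) ≡ x
      no-fixed   : ∀ {x} → x ∈ L → ι x ≢ x
      reverses   : ∀ {x} → x ∈ L → w (ι x) ≡ - w x

  SignReversing-delete : ∀ {w ι x} (pre : List X) {post} → Unique (x ∷ pre ++ ι x ∷ post) →
                         SignReversing w ι (x ∷ pre ++ ι x ∷ post) →
                         SignReversing w ι (pre ++ post)
  SignReversing-delete {w} {ι} {x} pre {post} (x∉ ∷ unique) sr = record
    { closed     = closed′
    ; involutive = involutive ∘′ lift
    ; no-fixed   = no-fixed ∘′ lift
    ; reverses   = reverses ∘′ lift
    }
    where
    open SignReversing sr
    lift : ∀ {z} → z ∈ pre ++ post → z ∈ x ∷ pre ++ ι x ∷ post
    lift z∈ = there (∈-undelete pre z∈)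
    ≢x : ∀ {z} → z ∈ pre ++ post → z ≢ x
    ≢x z∈ refl = All.lookup x∉ (∈-undelete pre z∈) refl
    ≢ιx : ∀ {z} → z ∈ pre ++ post → z ≢ ι x
    ≢ιx z∈ refl = Unique-deleted∉ pre unique z∈
    -- ι z is neither x nor ι x, since ι is injective on L
    closed′ : ∀ {z} → z ∈ pre ++ post → ι z ∈ pre ++ post
    closed′ z∈ with closed (lift z∈)
    ... | here ιz≡x = ⊥-elim (≢ιx z∈ (trans (sym (involutive (lift z∈))) (cong ι ιz≡x)))
    ... | there ιz∈ = ∈-delete pre ιz∈ λ ιz≡ιx → ≢x z∈
            (trans (sym (involutive (lift z∈))) (trans (cong ι ιz≡ιx) (involutive (here refl))))

  sum-sign-reversing : (w : X → ℤ) (ι : X → X) (L : List X) → Unique L →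
                       SignReversing w ι L → sumℤ (map w L) ≡ 0ℤ
  sum-sign-reversing w ι L = cancel (length L) L ≤-refl
    where
    cancel : ∀ bound L → length L ≤ bound → Unique L → SignReversing w ι L →
             sumℤ (map w L) ≡ 0ℤ
    cancel _ [] _ _ _ = refl
    cancel (suc bound) (x ∷ rest) (s≤s len) unique sr with SignReversing.closed sr (here refl)
    ... | here ιx≡x = ⊥-elim (SignReversing.no-fixed sr (here refl) ιx≡x)
    ... | there ιx∈ with ∈-∃++ ιx∈
    ... | pre , post , refl =
      trans (sumℤ-delete-pair w pre (SignReversing.reverses sr (here refl)))
            (cancel bound (pre ++ post) len′ (Unique-delete pre (AllPairs.tail unique))
                    (SignReversing-delete pre unique sr))
      where
      len′ : length (pre ++ post) ≤ bound
      len′ = ≤-trans (n≤1+n _) (subst (_≤ bound) (sym (length-delete pre)) len)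

sign-step : ∀ {r r′} → r′ ≡ suc r ⊎ suc r′ ≡ r → -1ℤ ^ r′ ≡ - (-1ℤ ^ r)
sign-step {r} (inj₁ refl) = ℤ.-1*i≡-i (-1ℤ ^ r)
sign-step {r′ = r′} (inj₂ refl) = begin
  -1ℤ ^ r′            ≡⟨ ℤ.neg-involutive (-1ℤ ^ r′) ⟨
  - - (-1ℤ ^ r′)      ≡⟨ cong -_ (ℤ.-1*i≡-i (-1ℤ ^ r′)) ⟨
  - (-1ℤ ^ suc r′)    ∎
  where open ≡-Reasoning

step-≢ : ∀ {r r′} → r′ ≡ suc r ⊎ suc r′ ≡ r → r′ ≢ r
step-≢ (inj₁ refl) = 1+n≢n
step-≢ (inj₂ refl) = 1+n≢n ∘ sym

vec-ext : ∀ {A : Set} {k} {xs ys : Vec A k} → (∀ u → lookup xs u ≡ lookup ys u) → xs ≡ ys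
vec-ext {xs = xs} {ys} same = begin
  xs                    ≡⟨ tabulate∘lookup xs ⟨
  tabulate (lookup xs)  ≡⟨ tabulate-cong same ⟩
  tabulate (lookup ys)  ≡⟨ tabulate∘lookup ys ⟩
  ys                    ∎
  where open ≡-Reasoning

squash : ℕ → ℕ → ℕ
squash i x with x ≤? i
... | yes _ = x
... | no  _ = pred x

stretch : ℕ → ℕ → ℕ
stretch i x with x ≤? i
... | yes _ = x
... | no  _ = suc x

squash-≤ : ∀ {i x} → x ≤ i → squash i x ≡ x
squash-≤ {i} {x} x≤i with x ≤? i
... | yes _   = refl
... | no  x≰i = ⊥-elim (x≰i x≤i)

squash-> : ∀ {i x} → i < x → squash i x ≡ pred x
squash-> {i} {x} i<x with x ≤? i
... | yes x≤i = ⊥-elim (<⇒≱ i<x x≤i)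
... | no  _   = refl

stretch-≤ : ∀ {i x} → x ≤ i → stretch i x ≡ x
stretch-≤ {i} {x} x≤i with x ≤? i
... | yes _   = refl
... | no  x≰i = ⊥-elim (x≰i x≤i)

stretch-> : ∀ {i x} → i < x → stretch i x ≡ suc x
stretch-> {i} {x} i<x with x ≤? i
... | yes x≤i = ⊥-elim (<⇒≱ i<x x≤i)
... | no  _   = refl

squash∘stretch : ∀ i x → squash i (stretch i x) ≡ x
squash∘stretch i x with x ≤? i
... | yes x≤i = squash-≤ x≤i
... | no  x≰i = squash-> (m<n⇒m<1+n (≰⇒> x≰i))

stretch∘squash : ∀ i x → x ≢ suc i → stretch i (squash i x) ≡ x
stretch∘squash i x x≢ with x ≤? i
... | yes x≤i = stretch-≤ x≤i
stretch∘squash i zero    x≢ | no x≰i = ⊥-elim (x≰i z≤n)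
stretch∘squash i (suc x) x≢ | no x≰i =
  stretch-> (≤∧≢⇒< (≤-pred (≰⇒> x≰i)) λ i≡x → x≢ (cong suc (sym i≡x)))

stretch≢ : ∀ i x → stretch i x ≢ suc i
stretch≢ i x with x ≤? i
... | yes x≤i = λ x≡ → <⇒≱ (s≤s ≤-refl) (subst (_≤ i) x≡ x≤i)
... | no  x≰i = λ x≡ → x≰i (≤-reflexive (suc-injective x≡))

stretch-mono : ∀ i {x y} → x < y → stretch i x < stretch i y
stretch-mono i {x} {y} x<y with x ≤? i | y ≤? i
... | yes _   | yes _   = x<y
... | yes _   | no  _   = m<n⇒m<1+n x<y
... | no  x≰i | yes y≤i = ⊥-elim (x≰i (≤-trans (<⇒≤ x<y) y≤i))
... | no  _   | no  _   = s≤s x<y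

squash-mono : ∀ i {x y} → x < y → (y ≡ suc i → x < i) → squash i x < squash i y
squash-mono i {x} {y} x<y avoid with x ≤? i | y ≤? i
... | yes _   | yes _   = x<y
... | no  x≰i | yes y≤i = ⊥-elim (x≰i (≤-trans (<⇒≤ x<y) y≤i))
squash-mono i {x} {suc y} x<y avoid | yes x≤i | no y≰i with m≤n⇒m<n∨m≡n (≤-pred (≰⇒> y≰i))
... | inj₁ i<y  = <-≤-trans (s≤s x≤i) i<y
... | inj₂ refl = avoid refl
squash-mono i {suc x} {suc y} x<y avoid | no _ | no _ = ≤-pred x<y
squash-mono i {zero}  {_}     x<y avoid | no x≰i | no _ = ⊥-elim (x≰i z≤n)

squash-bound : ∀ {i r x} → i < r → x ≤ r → squash i x ≤ pred r
squash-bound {i} {r} {x} i<r x≤r with x ≤? i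
... | yes x≤i = ≤-trans x≤i (<⇒≤pred i<r)
... | no  _   = pred-mono-≤ x≤r

stretch-bound : ∀ {i r x} → x ≤ r → stretch i x ≤ suc r
stretch-bound {i} {r} {x} x≤r with x ≤? i
... | yes _ = m≤n⇒m≤1+n x≤r
... | no  _ = s≤s x≤r

stretch-bound-pred : ∀ {i r y} → i < r → y ≤ pred r → stretch i y ≤ r
stretch-bound-pred {i} {r} {y} i<r y≤ with y ≤? i
... | yes y≤i = ≤-trans y≤i (<⇒≤ i<r)
stretch-bound-pred {i} {suc r} {y} i<r y≤ | no _ = s≤s y≤

allFuns-complete : ∀ k s (c : Fin k → Fin s) → ∃ λ c′ → c′ ∈ allFuns k s × c′ ≗ c
allFuns-complete zero    s c = _ , here refl , λ ()
allFuns-complete (suc k) s c with allFuns-complete k s (c ∘ fsuc)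
... | c′ , c′∈ , c′≗ =
  _ , ∈-concatMap⁺ _ (Any.map (λ { refl → ∈-map⁺ _ c′∈ }) (∈-allFin (c fzero)))
    , λ { fzero → refl ; (fsuc i) → c′≗ i }

allFuns-distinct : ∀ k s → AllPairs (λ c d → ¬ c ≗ d) (allFuns k s)
allFuns-distinct zero    s = All.[] ∷ []
allFuns-distinct (suc k) s =
  AllPairs.concat⁺ (All.map⁺ (All.universal same-head (allFin s)))
                   (AllPairs.map⁺ (AllPairs.map different-heads (allFin⁺ s)))
  where
  -- the functions extending a fixed value at fzero (the anonymous extension of allFuns)
  same-head : ∀ x → AllPairs (λ c d → ¬ c ≗ d) (map _ (allFuns k s))
  same-head x = AllPairs.map⁺ (AllPairs.map (λ c≉d c≗d → c≉d (c≗d ∘ fsuc)) (allFuns-distinct k s))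
  different-heads : ∀ {x y} → x ≢ y →
    All (λ c → All (λ d → ¬ c ≗ d) (map _ (allFuns k s))) (map _ (allFuns k s))
  different-heads x≢y = All.map⁺ (All.universal (λ _ → All.map⁺ (All.universal (λ _ c≗d → x≢y (c≗d fzero)) _)) _)

-- Pigeonhole: a map Fin k → ℕ hitting each of 0,…,r needs r+1 ≤ k
-- points; so the length of a colouring is less than the number of vertices.
onto⇒< : ∀ {k r} (g : Fin k → ℕ) → (∀ i → i ≤ r → ∃ λ u → g u ≡ i) → r < k
onto⇒< {k} {r} g onto with suc r ≤? k
... | yes r<k = r<k
... | no  r≮k =
  let i , j , i<j , same = Fin.pigeonhole (≰⇒> r≮k) point
  in ⊥-elim (<-irrefl (trans (sym (point-hits i)) (trans (cong g same) (point-hits j))) i<j)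
  where
  point : Fin (suc r) → Fin k
  point i = proj₁ (onto (toℕ i) (≤-pred (Fin.toℕ<n i)))
  point-hits : ∀ i → g (point i) ≡ toℕ i
  point-hits i = proj₂ (onto (toℕ i) (≤-pred (Fin.toℕ<n i)))

module _ {n m : ℕ} (cls : Fin m → Fin n) (F : ReducedForest m) where
  open ReducedForest F

  Mixed : Fin k → Set
  Mixed = HasMixedLeafChildren cls F

  -- Membership in 𝒞_F of length r, for a colouring g whose colours are
  -- read as natural numbers.
  record Valid (r : ℕ) (g : Fin k → ℕ) : Set where
    field
      bounded       : ∀ u → g u ≤ r
      onto          : ∀ i → i ≤ r → ∃ λ u → g u ≡ i
      leaves-zero   : ∀ u → IsLeaf parent u → g u ≡ 0
      decreasing    : ∀ u w → ChildOf parent w u → g w < g u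
      weakly-mixing : (∃ λ u → g u ≡ 1 × Mixed u) ⊎ (∀ u → g u ≢ 1)

  Valid-cong : ∀ {r g h} → g ≗ h → Valid r g → Valid r h
  Valid-cong {r} g≗h V = record
    { bounded       = λ u → subst (_≤ r) (g≗h u) (bounded u)
    ; onto          = λ i i≤r → let u , gu≡i = onto i i≤r in u , trans (sym (g≗h u)) gu≡i
    ; leaves-zero   = λ u leaf → trans (sym (g≗h u)) (leaves-zero u leaf)
    ; decreasing    = λ u w w◁u → subst₂ _<_ (g≗h w) (g≗h u) (decreasing u w w◁u)
    ; weakly-mixing = Sum.map (λ (u , gu≡1 , mixed) → u , trans (sym (g≗h u)) gu≡1 , mixed)
                              (λ no-1 u hu≡1 → no-1 u (trans (g≗h u) hu≡1)) weakly-mixing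
    }
    where open Valid V

  InC⇒Valid : ∀ {r} (c : Fin k → Fin (suc r)) → InC cls F r c → Valid r (toℕ ∘ c)
  InC⇒Valid c ((every-colour , leaves , decr) , wm) = record
    { bounded       = λ u → ≤-pred (Fin.toℕ<n (c u))
    ; onto          = λ i i≤r → let u , cu≡ = every-colour (fromℕ< (s≤s i≤r))
                                in u , trans (cong toℕ cu≡) (Fin.toℕ-fromℕ< _)
    ; leaves-zero   = λ u leaf → cong toℕ (leaves u leaf)
    ; decreasing    = decr
    ; weakly-mixing = wm
    }

  Valid⇒InC : ∀ {r} (c : Fin k → Fin (suc r)) → Valid r (toℕ ∘ c) → InC cls F r c
  Valid⇒InC c V =
    ( (λ j → let u , cu≡j = onto (toℕ j) (≤-pred (Fin.toℕ<n j)) in u , Fin.toℕ-injective cu≡j)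
    , (λ u leaf → Fin.toℕ-injective (leaves-zero u leaf))
    , decreasing )
    , weakly-mixing
    where open Valid V

  encode : ∀ {s} → (Fin k → Fin s) → Vec ℕ k
  encode c = tabulate (toℕ ∘ c)

  colourings-of-length : ℕ → List (ℕ × Vec ℕ k)
  colourings-of-length r = map (λ c → r , encode c) (𝒞 cls F r)

  colourings : List (ℕ × Vec ℕ k)
  colourings = concatMap colourings-of-length (upTo (suc k))

  sign : ℕ × Vec ℕ k → ℤ
  sign (r , _) = -1ℤ ^ r

  signedSum-colourings : signedSum cls F ≡ sumℤ (map sign colourings)
  signedSum-colourings = cong sumℤ (sym (begin
    map sign colourings
      ≡⟨ map-concatMap sign colourings-of-length (upTo (suc k)) ⟩
    concatMap (map sign ∘ colourings-of-length) (upTo (suc k))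
      ≡⟨ concatMap-cong (λ r → sym (map-∘ (𝒞 cls F r))) (upTo (suc k)) ⟩
    concatMap (λ r → map (λ _ → -1ℤ ^ r) (𝒞 cls F r)) (upTo (suc k)) ∎))
    where open ≡-Reasoning

  ∈colourings⇒Valid : ∀ {r xs} → (r , xs) ∈ colourings → Valid r (lookup xs)
  ∈colourings⇒Valid r,xs∈
    with r′ , r,xs∈′ ← Any.satisfied (∈-concatMap⁻ colourings-of-length {xs = upTo (suc k)} r,xs∈)
    with c , c∈ , refl ← ∈-map⁻ _ r,xs∈′
    with _ , c∈C ← ∈-filter⁻ (InC? cls F r′) {xs = allFuns k (suc r′)} c∈
    = Valid-cong (λ u → sym (lookup∘tabulate (toℕ ∘ c) u)) (InC⇒Valid c c∈C)

  Valid⇒∈colourings : ∀ {r xs} → Valid r (lookup xs) → (r , xs) ∈ colourings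
  Valid⇒∈colourings {r} {xs} V =
    ∈-concatMap⁺ colourings-of-length
      (Any.map (λ { refl → subst (λ ys → (r , ys) ∈ colourings-of-length r) encode-c≡xs r,c∈ })
               (∈-upTo⁺ (m≤n⇒m≤1+n (onto⇒< (lookup xs) (Valid.onto V)))))
    where
    colour : Fin k → Fin (suc r)
    colour u = fromℕ< (s≤s (Valid.bounded V u))
    listed : ∃ λ c → c ∈ allFuns k (suc r) × c ≗ colour
    listed = allFuns-complete k (suc r) colour
    c : Fin k → Fin (suc r)
    c = proj₁ listed
    lookup≗c : lookup xs ≗ toℕ ∘ c
    lookup≗c u = trans (sym (Fin.toℕ-fromℕ< _)) (cong toℕ (sym (proj₂ (proj₂ listed) u)))
    r,c∈ : (r , encode c) ∈ colourings-of-length r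
    r,c∈ = ∈-map⁺ _ (∈-filter⁺ (InC? cls F r) (proj₁ (proj₂ listed)) (Valid⇒InC c (Valid-cong lookup≗c V)))
    encode-c≡xs : encode c ≡ xs
    encode-c≡xs = trans (tabulate-cong (λ u → sym (lookup≗c u))) (tabulate∘lookup xs)

  colourings-unique : Unique colourings
  colourings-unique =
    AllPairs.concat⁺ (All.map⁺ (All.universal same-length _))
                     (AllPairs.map⁺ (AllPairs.map different-lengths (upTo⁺ (suc k))))
    where
    encode-injective : ∀ {r} {c d : Fin k → Fin (suc r)} → encode c ≡ encode d → c ≗ d
    encode-injective {c = c} {d} eq u = Fin.toℕ-injective (begin
      toℕ (c u)              ≡⟨ lookup∘tabulate (toℕ ∘ c) u ⟨
      lookup (encode c) u    ≡⟨ cong (λ ys → lookup ys u) eq ⟩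
      lookup (encode d) u    ≡⟨ lookup∘tabulate (toℕ ∘ d) u ⟩
      toℕ (d u)              ∎)
      where open ≡-Reasoning
    same-length : ∀ r → Unique (colourings-of-length r)
    same-length r = AllPairs.map⁺ (AllPairs.map (λ c≉d eq → c≉d (encode-injective (cong proj₂ eq)))
                                                (AllPairs.filter⁺ (InC? cls F r) (allFuns-distinct k (suc r))))
    different-lengths : ∀ {r r′} → r ≢ r′ →
      All (λ x → All (x ≢_) (colourings-of-length r′)) (colourings-of-length r)
    different-lengths r≢r′ =
      All.map⁺ (All.universal (λ _ → All.map⁺ (All.universal (λ _ eq → r≢r′ (cong proj₁ eq)) _)) _)

  record UnmixedVertex : Set where
    field
      v             : Fin k
      child         : Fin k
      child◁v       : ChildOf parent child v
      leaf-children : ∀ w → ChildOf parent w v → IsLeaf parent w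
      unmixed       : ¬ Mixed v

  childOf? : ∀ w u → Dec (ChildOf parent w u)
  childOf? w u = ≡-dec Fin._≟_ (parent w) (just u)

  isLeaf? : ∀ u → Dec (IsLeaf parent u)
  isLeaf? u = Fin.all? λ w → ¬? (childOf? w u)

  leafChildren? : ∀ u → Dec (∀ w → ChildOf parent w u → IsLeaf parent w)
  leafChildren? u = Fin.all? λ w → childOf? w u →-dec isLeaf? w

  mixed? : ∀ u → Dec (Mixed u)
  mixed? u = Fin.any? λ a → Fin.any? λ b →
    childOf? (lab a) u ×-dec childOf? (lab b) u ×-dec ¬? (cls a Fin.≟ cls b)

  -- As all these predicates are decidable, a failure of Mixing exhibits
  -- an unmixed vertex.
  ¬Mixing⇒UnmixedVertex : ¬ Mixing cls F → UnmixedVertex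
  ¬Mixing⇒UnmixedVertex ¬mixing
    with v , fails ← Fin.¬∀⟶∃¬ k _ (λ u → ¬? (isLeaf? u) →-dec (leafChildren? u →-dec mixed? u)) ¬mixing
    with child , ¬¬child◁v ← Fin.¬∀⟶∃¬ k _ (λ w → ¬? (childOf? w v))
                                        (λ leaf → fails (λ ¬leaf → ⊥-elim (¬leaf leaf)))
    = record
    { v             = v
    ; child         = child
    ; child◁v       = decidable-stable (childOf? child v) ¬¬child◁v
    ; leaf-children = decidable-stable (leafChildren? v) λ ¬lc → fails (λ _ lc → ⊥-elim (¬lc lc))
    ; unmixed       = λ mixed → fails (λ _ _ → mixed)
    }

  module Involution (o : UnmixedVertex) where
    open UnmixedVertex o

    Shared : Vec ℕ k → Set
    Shared xs = ∃ λ u → u ≢ v × lookup xs u ≡ lookup xs v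

    shared? : ∀ xs → Dec (Shared xs)
    shared? xs = Fin.any? λ u → ¬? (u Fin.≟ v) ×-dec (lookup xs u ℕ.≟ lookup xs v)

    Lonely : Vec ℕ k → Set
    Lonely xs = ¬ Shared xs × 2 ≤ lookup xs v

    lonely? : ∀ xs → Dec (Lonely xs)
    lonely? xs = ¬? (shared? xs) ×-dec (2 ≤? lookup xs v)

    merge : Vec ℕ k → Vec ℕ k
    merge xs = Vec.map (squash (pred (lookup xs v))) xs

    split : Vec ℕ k → Vec ℕ k
    split xs = Vec.map (stretch (lookup xs v)) xs [ v ]≔ suc (lookup xs v)

    flip : ℕ × Vec ℕ k → ℕ × Vec ℕ k
    flip (r , xs) with lonely? xs
    ... | yes _ = pred r , merge xs
    ... | no  _ = suc r , split xs

    flip-lonely : ∀ {r xs} → Lonely xs → flip (r , xs) ≡ (pred r , merge xs)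
    flip-lonely {r} {xs} lonely with lonely? xs
    ... | yes _       = refl
    ... | no ¬lonely  = ⊥-elim (¬lonely lonely)

    flip-not-lonely : ∀ {r xs} → ¬ Lonely xs → flip (r , xs) ≡ (suc r , split xs)
    flip-not-lonely {r} {xs} ¬lonely with lonely? xs
    ... | yes lonely = ⊥-elim (¬lonely lonely)
    ... | no  _      = refl

    lookup-merge : ∀ xs u → lookup (merge xs) u ≡ squash (pred (lookup xs v)) (lookup xs u)
    lookup-merge xs u = lookup-map u _ xs

    lookup-split-v : ∀ xs → lookup (split xs) v ≡ suc (lookup xs v)
    lookup-split-v xs = lookup∘update v (Vec.map (stretch (lookup xs v)) xs) _

    lookup-split : ∀ xs {u} → u ≢ v → lookup (split xs) u ≡ stretch (lookup xs v) (lookup xs u)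
    lookup-split xs u≢v =
      trans (lookup∘update′ u≢v (Vec.map (stretch (lookup xs v)) xs) _) (lookup-map _ _ xs)

    module Valid-at {r : ℕ} (xs : Vec ℕ k) (V : Valid r (lookup xs)) where
      open Valid V public

      j : ℕ
      j = lookup xs v

      children-zero : ∀ w → ChildOf parent w v → lookup xs w ≡ 0
      children-zero w w◁v = leaves-zero w (leaf-children w w◁v)

      1≤j : 1 ≤ j
      1≤j = subst (_< j) (children-zero child child◁v) (decreasing v child child◁v)

      v-non-leaf : ∀ {u} → IsLeaf parent u → u ≢ v
      v-non-leaf leaf refl = leaf child child◁v

      -- colour 1 is used (as 1 ≤ j ≤ r), so weak mixing gives a mixed vertex of colour 1
      mixed-at-1 : ∃ λ u → lookup xs u ≡ 1 × Mixed u
      mixed-at-1 with weakly-mixing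
      ... | inj₁ found = found
      ... | inj₂ no-1  = let u , xu≡1 = onto 1 (≤-trans 1≤j (bounded v)) in ⊥-elim (no-1 u xu≡1)

      mixed⇒≢v : ∀ {u} → Mixed u → u ≢ v
      mixed⇒≢v mixed refl = unmixed mixed

      -- when v is not lonely, another vertex shares its colour
      -- (if j = 1 this is the mixed vertex of colour 1)
      ¬lonely⇒shared : ¬ Lonely xs → Shared xs
      ¬lonely⇒shared ¬lonely with 2 ≤? j
      ... | yes 2≤j = decidable-stable (shared? xs) (λ ¬shared → ¬lonely (¬shared , 2≤j))
      ... | no  2≰j =
        let u , xu≡1 , mixed = mixed-at-1
        in u , mixed⇒≢v mixed , trans xu≡1 (≤-antisym 1≤j (≤-pred (≰⇒> 2≰j)))

    module Merge {r : ℕ} (xs : Vec ℕ k) (V : Valid r (lookup xs)) (lonely : Lonely xs) where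
      open Valid-at xs V

      i : ℕ
      i = pred j

      j≡suc-i : j ≡ suc i
      j≡suc-i = sym (suc-pred j {{>-nonZero 1≤j}})

      1≤i : 1 ≤ i
      1≤i = pred-mono-≤ (proj₂ lonely)

      i<r : i < r
      i<r = subst (_≤ r) j≡suc-i (bounded v)

      alone : ∀ {u} → lookup xs u ≡ suc i → u ≡ v
      alone {u} xu≡ = decidable-stable (u Fin.≟ v) λ u≢v → proj₁ lonely (u , u≢v , trans xu≡ (sym j≡suc-i))

      valid : Valid (pred r) (lookup (merge xs))
      valid = Valid-cong (λ u → sym (lookup-merge xs u)) (record
        { bounded       = λ u → squash-bound i<r (bounded u)
        ; onto          = λ y y≤ → let u , xu≡ = onto (stretch i y) (stretch-bound-pred i<r y≤)
                                   in u , trans (cong (squash i) xu≡) (squash∘stretch i y)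
        ; leaves-zero   = λ u leaf → trans (cong (squash i) (leaves-zero u leaf)) (squash-≤ {i} z≤n)
        ; decreasing    = λ u w w◁u → squash-mono i (decreasing u w w◁u) (below-v w◁u)
        ; weakly-mixing = let u , xu≡1 , mixed = mixed-at-1
                          in inj₁ (u , trans (cong (squash i) xu≡1) (squash-≤ 1≤i) , mixed)
        })
        where
        -- the only edges from colour suc i lead to leaves of colour 0 < i
        below-v : ∀ {u w} → ChildOf parent w u → lookup xs u ≡ suc i → lookup xs w < i
        below-v {w = w} w◁u xu≡ with refl ← alone xu≡ = subst (_< i) (sym (children-zero w w◁u)) 1≤i

      v↦i : lookup (merge xs) v ≡ i
      v↦i = trans (lookup-merge xs v) (trans (cong (squash i) j≡suc-i) (squash-> ≤-refl))

      -- the merged colouring is not lonely: colour i is also carried by a vertex other than v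
      not-lonely : ¬ Lonely (merge xs)
      not-lonely (¬shared , _) =
        let u , xu≡i = onto i (<⇒≤ i<r)
            u≢v : u ≢ v
            u≢v u≡v = 1+n≢n (trans (sym j≡suc-i) (trans (cong (lookup xs) (sym u≡v)) xu≡i))
        in ¬shared (u , u≢v , trans (lookup-merge xs u) (trans (cong (squash i) xu≡i)
                                 (trans (squash-≤ ≤-refl) (sym v↦i))))

      split∘merge : split (merge xs) ≡ xs
      split∘merge = vec-ext restore
        where
        restore : ∀ u → lookup (split (merge xs)) u ≡ lookup xs u
        restore u with u Fin.≟ v
        ... | yes refl = trans (lookup-split-v (merge xs)) (trans (cong suc v↦i) (sym j≡suc-i))
        ... | no  u≢v  = begin
          lookup (split (merge xs)) u                          ≡⟨ lookup-split (merge xs) u≢v ⟩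
          stretch (lookup (merge xs) v) (lookup (merge xs) u)  ≡⟨ cong₂ stretch v↦i (lookup-merge xs u) ⟩
          stretch i (squash i (lookup xs u))                   ≡⟨ stretch∘squash i _ (u≢v ∘ alone) ⟩
          lookup xs u                                          ∎
          where open ≡-Reasoning

      length-restored : suc (pred r) ≡ r
      length-restored = suc-pred r {{>-nonZero (<-≤-trans z<s i<r)}}

    module Split {r : ℕ} (xs : Vec ℕ k) (V : Valid r (lookup xs)) (¬lonely : ¬ Lonely xs) where
      open Valid-at xs V

      off-v : ∀ x → x ≤ r → ∃ λ u → u ≢ v × lookup xs u ≡ x
      off-v x x≤r with x ℕ.≟ j
      ... | yes refl = ¬lonely⇒shared ¬lonely
      ... | no  x≢j  = let u , xu≡x = onto x x≤r in u , (λ { refl → x≢j (sym xu≡x) }) , xu≡x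

      -- colour suc j is v's; any other colour y is stretch j of the colour squash j y ≠ suc j
      onto′ : ∀ y → y ≤ suc r → ∃ λ u → lookup (split xs) u ≡ y
      onto′ y y≤ with y ℕ.≟ suc j
      ... | yes refl = v , lookup-split-v xs
      ... | no  y≢   =
        let u , u≢v , xu≡ = off-v (squash j y) (squash-bound (s≤s (bounded v)) y≤)
        in u , trans (lookup-split xs u≢v) (trans (cong (stretch j) xu≡) (stretch∘squash j y y≢))

      -- the children of v keep colour 0 < suc j; the parent of v had a colour above j
      decreasing′ : ∀ u w → ChildOf parent w u → lookup (split xs) w < lookup (split xs) u
      decreasing′ u w w◁u with u Fin.≟ v | w Fin.≟ v
      ... | yes refl | yes refl = ⊥-elim (<-irrefl refl (decreasing u w w◁u))
      ... | yes refl | no  w≢v  = begin-strict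
        lookup (split xs) w        ≡⟨ lookup-split xs w≢v ⟩
        stretch j (lookup xs w)    ≡⟨ cong (stretch j) (children-zero w w◁u) ⟩
        stretch j 0                ≡⟨ stretch-≤ {j} z≤n ⟩
        0                          <⟨ z<s ⟩
        suc j                      ≡⟨ lookup-split-v xs ⟨
        lookup (split xs) v        ∎
        where open ≤-Reasoning
      ... | no  u≢v  | yes refl = begin-strict
        lookup (split xs) v        ≡⟨ lookup-split-v xs ⟩
        suc j                      <⟨ s≤s (decreasing u v w◁u) ⟩
        suc (lookup xs u)          ≡⟨ stretch-> (decreasing u v w◁u) ⟨
        stretch j (lookup xs u)    ≡⟨ lookup-split xs u≢v ⟨
        lookup (split xs) u        ∎
        where open ≤-Reasoning
      ... | no  u≢v  | no  w≢v  = subst₂ _<_ (sym (lookup-split xs w≢v)) (sym (lookup-split xs u≢v))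
                                          (stretch-mono j (decreasing u w w◁u))

      valid : Valid (suc r) (lookup (split xs))
      valid = record
        { bounded       = bounded′
        ; onto          = onto′
        ; leaves-zero   = λ u leaf → trans (lookup-split xs (v-non-leaf leaf))
                                       (trans (cong (stretch j) (leaves-zero u leaf)) (stretch-≤ {j} z≤n))
        ; decreasing    = decreasing′
        ; weakly-mixing = let u , xu≡1 , mixed = mixed-at-1
                          in inj₁ (u , trans (lookup-split xs (mixed⇒≢v mixed))
                                         (trans (cong (stretch j) xu≡1) (stretch-≤ 1≤j)) , mixed)
        }
        where
        bounded′ : ∀ u → lookup (split xs) u ≤ suc r
        bounded′ u with u Fin.≟ v
        ... | yes refl = subst (_≤ suc r) (sym (lookup-split-v xs)) (s≤s (bounded v))
        ... | no  u≢v  = subst (_≤ suc r) (sym (lookup-split xs u≢v)) (stretch-bound (bounded u))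

      lonely : Lonely (split xs)
      lonely = (λ (u , u≢v , same) → stretch≢ j (lookup xs u)
                 (trans (sym (lookup-split xs u≢v)) (trans same (lookup-split-v xs))))
             , subst (2 ≤_) (sym (lookup-split-v xs)) (s≤s 1≤j)

      merge∘split : merge (split xs) ≡ xs
      merge∘split = vec-ext restore
        where
        restore : ∀ u → lookup (merge (split xs)) u ≡ lookup xs u
        restore u with u Fin.≟ v
        ... | yes refl = trans (lookup-merge (split xs) v)
                           (trans (cong (λ y → squash (pred y) y) (lookup-split-v xs)) (squash-> ≤-refl))
        ... | no  u≢v  = begin
          lookup (merge (split xs)) u                        ≡⟨ lookup-merge (split xs) u ⟩
          squash (pred (lookup (split xs) v)) (lookup (split xs) u)
            ≡⟨ cong₂ (λ y z → squash (pred y) z) (lookup-split-v xs) (lookup-split xs u≢v) ⟩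
          squash j (stretch j (lookup xs u))                 ≡⟨ squash∘stretch j _ ⟩
          lookup xs u                                        ∎
          where open ≡-Reasoning

    record Flips (r : ℕ) (xs : Vec ℕ k) (flipped : ℕ × Vec ℕ k) : Set where
      field
        valid       : Valid (proj₁ flipped) (lookup (proj₂ flipped))
        length-step : proj₁ flipped ≡ suc r ⊎ suc (proj₁ flipped) ≡ r
        involutive  : flip flipped ≡ (r , xs)

    flips : ∀ {r xs} → Valid r (lookup xs) → Flips r xs (flip (r , xs))
    flips {r} {xs} V = by-cases (lonely? xs)
      where
      by-cases : Dec (Lonely xs) → Flips r xs (flip (r , xs))
      by-cases (yes lonely) = subst (Flips r xs) (sym (flip-lonely lonely)) record
        { valid       = valid
        ; length-step = inj₂ length-restored
        ; involutive  = trans (flip-not-lonely not-lonely) (cong₂ _,_ length-restored split∘merge)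
        }
        where open Merge xs V lonely
      by-cases (no ¬lonely) = subst (Flips r xs) (sym (flip-not-lonely ¬lonely)) record
        { valid       = valid
        ; length-step = inj₁ refl
        ; involutive  = trans (flip-lonely lonely) (cong (r ,_) merge∘split)
        }
        where open Split xs V ¬lonely

    signedSum≡0 : signedSum cls F ≡ 0ℤ
    signedSum≡0 = trans signedSum-colourings
      (sum-sign-reversing sign flip colourings colourings-unique record
        { closed     = λ x∈ → Valid⇒∈colourings (Flips.valid (flips-at x∈))
        ; involutive = λ x∈ → Flips.involutive (flips-at x∈)
        ; no-fixed   = λ x∈ same → step-≢ (Flips.length-step (flips-at x∈)) (cong proj₁ same)
        ; reverses   = λ x∈ → sign-step (Flips.length-step (flips-at x∈))
        })
      where
      flips-at : ∀ {x} → x ∈ colourings → Flips (proj₁ x) (proj₂ x) (flip x)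
      flips-at x∈ = flips (∈colourings⇒Valid x∈)

lemma3p4 : (n m : ℕ) (cls : Fin m → Fin n) (F : ReducedForest m) →
           ¬ Mixing cls F → signedSum cls F ≡ 0ℤ
lemma3p4 n m cls F ¬mixing = Involution.signedSum≡0 cls F (¬Mixing⇒UnmixedVertex cls F ¬mixing)
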